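{- Let $A$ be an implicative-disjunctive formula and $V$ a truth value assignment. - If $V(A)=T$, then $\Gamma[V;A] \vdash_{id} (\Delta[V;A])^{A}$. - If $V(A)=F$, then $\Gamma[V;A] \vdash_{id} (\Delta[V;A])^{\sim A}$.
   Context: **Language.** Formulas are built from the atomic formulas $p_1, p_2, \dots$ using the binary connectives $\to$, $\vee$ and $\&$. Implicative-disjunctive formulas are those without $\&$. Iterated connectives associate to the right. For example, $B_1 \vee \dots \vee B_n \vee A$ means $B_1 \vee (B_2 \vee (\dots \vee (B_n \vee A)))$, and for $n=1$ $B_1 \vee \dots \vee B_n$ is $B_1$. All formulas are arranged in a fixed decidable linear order $R$ (e.g. via Gödel numbering). **Semantics.** A truth value assignment is a map $V$ from formulas to $\{T,F\}$ obeying the classical truth conditions for $\to$, $\vee$ and $\&$. **Notation.** - $\Gamma[V;A]$ is the set of atomic subformulas $B$ of $A$ with $V(B)=T$. - $\Delta[V;A]$ is the set of atomic subformulas $B$ of $A$ with $V(B)=F$. - For a finite set $K$ of formulas, let $B_1, \dots, B_n$ be its distinct elements listed in the order $R$. - $(K)^{A}$ is $A$ if $K$ is empty, and $B_1 \vee \dots \vee B_n \vee A$ otherwise. - $(K)^{\sim A}$ is $A$ if $K$ is empty, and $A \to (B_1 \vee \dots \vee B_n)$ otherwise. **Calculus.** $K \vdash_{id} C$ means that $C$ is derivable from the members of $K$ in the classical implicative-disjunctive propositional calculus. Its axiom schemes are: - $A \to B \to A$; - $(A \to B \to C) \to (A \to B) \to A \to C$; - $((A \to B) \to A) \to A$; -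 $A \to (A \vee B)$; - $A \to (B \vee A)$; - $(A \to C) \to (B \to C) \to (A \vee B) \to C$. Its only rule is modus ponens. -}

module Defs where

open import Data.Nat using (ℕ; zero; suc; _⊔_; _≡ᵇ_)
open import Data.Bool using (Bool; true; false; _∧_; _∨_; not; if_then_else_; T)
open import Data.List using (List; []; _∷_; upTo; filterᵇ; map)
open import Data.List.Membership.Propositional using (_∈_)
open import Relation.Binary.PropositionalEquality using (_≡_)

-- Formulas over atoms p_1, p_2, … (atom i is p_i; index 0 also allowed,
-- which is harmless: the atoms are just a countable family).
infixr 5 _⇒_
infixr 6 _∨ᶠ_
infixr 7 _&_
data Form : Set where
  atom : ℕ → Form
  _⇒_  : Form → Form → Form
  _∨ᶠ_ : Form → Form → Form
  _&_  : Form → Form → Form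

data IsID : Form → Set where
  atom : ∀ i → IsID (atom i)
  imp  : ∀ {A B} → IsID A → IsID B → IsID (A ⇒ B)
  or   : ∀ {A B} → IsID A → IsID B → IsID (A ∨ᶠ B)

record Valuation : Set where
  field
    val   : Form → Bool
    val-⇒ : ∀ A B → val (A ⇒ B) ≡ (not (val A) ∨ val B)
    val-∨ : ∀ A B → val (A ∨ᶠ B) ≡ (val A ∨ val B)
    val-& : ∀ A B → val (A & B) ≡ (val A ∧ val B)
open Valuation public

occurs : ℕ → Form → Bool
occurs i (atom j) = i ≡ᵇ j
occurs i (A ⇒ B)  = occurs i A ∨ occurs i B
occurs i (A ∨ᶠ B) = occurs i A ∨ occurs i B
occurs i (A & B)  = occurs i A ∨ occurs i B

maxAtom : Form → ℕ
maxAtom (atom j) = j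
maxAtom (A ⇒ B)  = maxAtom A ⊔ maxAtom B
maxAtom (A ∨ᶠ B) = maxAtom A ⊔ maxAtom B
maxAtom (A & B)  = maxAtom A ⊔ maxAtom B

-- The fixed order R: atoms are ordered by their index (p_i before p_j iff
-- i < j), as with a standard Gödel numbering. Finite sets of atoms are
-- represented as the list of their distinct elements in R-order.
atomsWith : (Bool → Bool) → Valuation → Form → List Form
atomsWith b V A =
  map atom (filterᵇ (λ i → occurs i A ∧ b (val V (atom i))) (upTo (suc (maxAtom A))))

Γ[_,_] : Valuation → Form → List Form
Γ[ V , A ] = atomsWith (λ x → x) V A

Δ[_,_] : Valuation → Form → List Form
Δ[ V , A ] = atomsWith not V A

bigOr₁ : Form → List Form → Form
bigOr₁ B []       = B
bigOr₁ B (C ∷ Cs) = B ∨ᶠ bigOr₁ C Cs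

_^⁺_ : List Form → Form → Form
[]       ^⁺ A = A
(B ∷ Bs) ^⁺ A = B ∨ᶠ (Bs ^⁺ A)

_^∼_ : List Form → Form → Form
[]       ^∼ A = A
(B ∷ Bs) ^∼ A = A ⇒ bigOr₁ B Bs

infix 3 _⊢id_
data _⊢id_ (K : List Form) : Form → Set where
  hyp : ∀ {A} → A ∈ K → K ⊢id A
  ax1 : ∀ A B → K ⊢id A ⇒ B ⇒ A
  ax2 : ∀ A B C → K ⊢id (A ⇒ B ⇒ C) ⇒ (A ⇒ B) ⇒ A ⇒ C
  ax3 : ∀ A B → K ⊢id ((A ⇒ B) ⇒ A) ⇒ A
  ax4 : ∀ A B → K ⊢id A ⇒ (A ∨ᶠ B)
  ax5 : ∀ A B → K ⊢id A ⇒ (B ∨ᶠ A)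
  ax6 : ∀ A B C → K ⊢id (A ⇒ C) ⇒ (B ⇒ C) ⇒ (A ∨ᶠ B) ⇒ C
  mp  : ∀ {A B} → K ⊢id A ⇒ B → K ⊢id A → K ⊢id B

-- Kalmár's lemma with an arbitrary formula D in the place of falsum: reading
-- A ⇒ D as ¬A, every implicative-disjunctive A is decided relative to D by
-- the decided atoms of A.
-- For V(A) = T take D := (Δ)^A, which every false atom implies; for V(A) = F
-- take D := the disjunction of Δ, which is nonempty since otherwise every atom
-- of A, and hence A itself, would be true.
module Submission where

open import Defs
open import Data.Bool using (Bool; true; false; _∧_; _∨_; not; T)
open import Data.Bool.Properties using (T?; T-≡; T-not-≡; T-∧; T-∨; ∨-zeroʳ)
open import Data.Nat using (_≤_; s≤s; _⊔_)
open import Data.Nat.Properties using (≡ᵇ⇒≡; ≡⇒≡ᵇ; ≤-reflexive; ≤-trans; m≤m⊔n; m≤n⊔m)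
open import Data.List using (List; []; _∷_)
open import Data.List.Membership.Propositional using (_∈_)
open import Data.List.Membership.Propositional.Properties using (∈-map⁺; ∈-upTo⁺; ∈-filter⁺)
open import Data.List.Relation.Binary.Subset.Propositional using (_⊆_)
open import Data.List.Relation.Unary.Any using (here; there)
open import Data.Product using (_×_; _,_)
open import Data.Sum using (inj₁; inj₂; [_,_]′)
open import Function using (Equivalence; _∘_)
open import Relation.Binary.PropositionalEquality using (_≡_; refl; sym; trans; subst)
open import Relation.Nullary using (contradiction)

open Equivalence using (to; from)

private
  variable
    K K′ : List Form
    A B C D : Form

weaken : K ⊆ K′ → K ⊢id A → K′ ⊢id A
weaken s (hyp p)     = hyp (s p)
weaken s (ax1 A B)   = ax1 A B
weaken s (ax2 A B C) = ax2 A B C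
weaken s (ax3 A B)   = ax3 A B
weaken s (ax4 A B)   = ax4 A B
weaken s (ax5 A B)   = ax5 A B
weaken s (ax6 A B C) = ax6 A B C
weaken s (mp f x)    = mp (weaken s f) (weaken s x)

weaken₁ : K ⊢id A → (B ∷ K) ⊢id A
weaken₁ = weaken there

hyp₀ : (A ∷ K) ⊢id A
hyp₀ = hyp (here refl)

hyp₁ : (B ∷ A ∷ K) ⊢id A
hyp₁ = hyp (there (here refl))

⇒-refl : K ⊢id A ⇒ A
⇒-refl {A = A} = mp (mp (ax2 A (A ⇒ A) A) (ax1 A (A ⇒ A))) (ax1 A A)

deduction : (A ∷ K) ⊢id B → K ⊢id A ⇒ B
deduction (hyp (here refl)) = ⇒-refl
deduction (hyp (there p))   = mp (ax1 _ _) (hyp p)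
deduction (ax1 A B)         = mp (ax1 _ _) (ax1 A B)
deduction (ax2 A B C)       = mp (ax1 _ _) (ax2 A B C)
deduction (ax3 A B)         = mp (ax1 _ _) (ax3 A B)
deduction (ax4 A B)         = mp (ax1 _ _) (ax4 A B)
deduction (ax5 A B)         = mp (ax1 _ _) (ax5 A B)
deduction (ax6 A B C)       = mp (ax1 _ _) (ax6 A B C)
deduction (mp f x)          = mp (mp (ax2 _ _ _) (deduction f)) (deduction x)

⇒-trans : K ⊢id A ⇒ B → K ⊢id B ⇒ C → K ⊢id A ⇒ C
⇒-trans f g = deduction (mp (weaken₁ g) (mp (weaken₁ f) hyp₀))

-- Negation relative to D: ¬A is A ⇒ D.

¬¬-intro : K ⊢id A → K ⊢id (A ⇒ D) ⇒ D
¬¬-intro a = deduction (mp hyp₀ (weaken₁ a))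

¬¬-map : K ⊢id A ⇒ B → K ⊢id (A ⇒ D) ⇒ D → K ⊢id (B ⇒ D) ⇒ D
¬¬-map f ¬¬A = deduction (mp (weaken₁ ¬¬A) (⇒-trans (weaken₁ f) hyp₀))

¬¬-¬⇒¬[⇒] : K ⊢id (A ⇒ D) ⇒ D → K ⊢id B ⇒ D → K ⊢id (A ⇒ B) ⇒ D
¬¬-¬⇒¬[⇒] ¬¬A ¬B = deduction (mp (weaken₁ ¬¬A) (⇒-trans hyp₀ (weaken₁ ¬B)))

-- Peirce's law ((D ⇒ B) ⇒ D) ⇒ D stands in for ex falso D ⇒ B.
¬⇒¬¬[⇒] : K ⊢id A ⇒ D → K ⊢id ((A ⇒ B) ⇒ D) ⇒ D
¬⇒¬¬[⇒] {A = A} {D = D} {B = B} ¬A =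
  deduction (mp (ax3 D B) (deduction (mp hyp₁ (⇒-trans (weaken₁ (weaken₁ ¬A)) hyp₀))))

decided : Form → Bool → Form → Form
decided D true  A = (A ⇒ D) ⇒ D
decided D false A = A ⇒ D

decided-⇒ : ∀ a b → K ⊢id decided D a A → K ⊢id decided D b B →
  K ⊢id decided D (not a ∨ b) (A ⇒ B)
decided-⇒ false b     ¬A  _   = ¬⇒¬¬[⇒] ¬A
decided-⇒ true  true  _   ¬¬B = ¬¬-map (ax1 _ _) ¬¬B
decided-⇒ true  false ¬¬A ¬B  = ¬¬-¬⇒¬[⇒] ¬¬A ¬B

decided-∨ : ∀ a b → K ⊢id decided D a A → K ⊢id decided D b B →
  K ⊢id decided D (a ∨ b) (A ∨ᶠ B)
decided-∨ true  b     ¬¬A _   = ¬¬-map (ax4 _ _) ¬¬A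
decided-∨ false true  _   ¬¬B = ¬¬-map (ax5 _ _) ¬¬B
decided-∨ false false ¬A  ¬B  = mp (mp (ax6 _ _ _) ¬A) ¬B

occursˡ : ∀ {i} A B → T (occurs i A) → T (occurs i A ∨ occurs i B)
occursˡ {i} A B = from (T-∨ {occurs i A} {occurs i B}) ∘ inj₁

occursʳ : ∀ {i} A B → T (occurs i B) → T (occurs i A ∨ occurs i B)
occursʳ {i} A B = from (T-∨ {occurs i A} {occurs i B}) ∘ inj₂

module _ (V : Valuation) where

  kalmár : IsID A →
    (∀ i → T (occurs i A) → K ⊢id decided D (val V (atom i)) (atom i)) →
    K ⊢id decided D (val V A) A
  kalmár (atom i) h = h i (≡⇒≡ᵇ i i refl)
  kalmár (imp {A} {B} idA idB) h rewrite val-⇒ V A B =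
    decided-⇒ (val V A) (val V B)
      (kalmár idA λ i → h i ∘ occursˡ A B) (kalmár idB λ i → h i ∘ occursʳ A B)
  kalmár (or {A} {B} idA idB) h rewrite val-∨ V A B =
    decided-∨ (val V A) (val V B)
      (kalmár idA λ i → h i ∘ occursˡ A B) (kalmár idB λ i → h i ∘ occursʳ A B)

  atoms-true⇒true : ∀ A → (∀ i → T (occurs i A) → val V (atom i) ≡ true) → val V A ≡ true
  atoms-true⇒true (atom i) h = h i (≡⇒≡ᵇ i i refl)
  atoms-true⇒true (A ⇒ B) h
    rewrite val-⇒ V A B | atoms-true⇒true B (λ i → h i ∘ occursʳ A B) = ∨-zeroʳ _
  atoms-true⇒true (A ∨ᶠ B) h
    rewrite val-∨ V A B | atoms-true⇒true B (λ i → h i ∘ occursʳ A B) = ∨-zeroʳ _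
  atoms-true⇒true (A & B) h
    rewrite val-& V A B | atoms-true⇒true A (λ i → h i ∘ occursˡ A B)
                        | atoms-true⇒true B (λ i → h i ∘ occursʳ A B) = refl

occurs⇒≤maxAtom : ∀ {i} A → T (occurs i A) → i ≤ maxAtom A
occurs-either⇒≤⊔ : ∀ {i} A B → T (occurs i A ∨ occurs i B) → i ≤ maxAtom A ⊔ maxAtom B

occurs⇒≤maxAtom (atom j) o = ≤-reflexive (≡ᵇ⇒≡ _ j o)
occurs⇒≤maxAtom (A ⇒ B)  o = occurs-either⇒≤⊔ A B o
occurs⇒≤maxAtom (A ∨ᶠ B) o = occurs-either⇒≤⊔ A B o
occurs⇒≤maxAtom (A & B)  o = occurs-either⇒≤⊔ A B o

occurs-either⇒≤⊔ {i} A B o =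
  [ (λ oA → ≤-trans (occurs⇒≤maxAtom A oA) (m≤m⊔n _ _))
  , (λ oB → ≤-trans (occurs⇒≤maxAtom B oB) (m≤n⊔m _ _))
  ]′ (to (T-∨ {occurs i A} {occurs i B}) o)

atom∈atomsWith : ∀ {i} b V A → T (occurs i A) → T (b (val V (atom i))) →
  atom i ∈ atomsWith b V A
atom∈atomsWith {i} b V A o t =
  ∈-map⁺ atom (∈-filter⁺ (λ j → T? (occurs j A ∧ b (val V (atom j))))
    (∈-upTo⁺ (s≤s (occurs⇒≤maxAtom A o)))
    (from (T-∧ {occurs i A} {b (val V (atom i))}) (o , t)))

atom∈Γ : ∀ {i} V A → T (occurs i A) → val V (atom i) ≡ true → atom i ∈ Γ[ V , A ]
atom∈Γ V A o e = atom∈atomsWith (λ x → x) V A o (from T-≡ e)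

atom∈Δ : ∀ {i} V A → T (occurs i A) → val V (atom i) ≡ false → atom i ∈ Δ[ V , A ]
atom∈Δ V A o e = atom∈atomsWith not V A o (from T-not-≡ e)

atoms-decided : ∀ V A → (∀ {q} → q ∈ Δ[ V , A ] → Γ[ V , A ] ⊢id q ⇒ D) →
  ∀ i → T (occurs i A) → Γ[ V , A ] ⊢id decided D (val V (atom i)) (atom i)
atoms-decided V A ¬Δ i o with val V (atom i) in e
... | true  = ¬¬-intro (hyp (atom∈Γ V A o e))
... | false = ¬Δ (atom∈Δ V A o e)

Δ-empty⇒true : ∀ V A → Δ[ V , A ] ≡ [] → val V A ≡ true
Δ-empty⇒true V A Δ≡[] = atoms-true⇒true V A atom-true
  where
  atom-true : ∀ i → T (occurs i A) → val V (atom i) ≡ true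
  atom-true i o with val V (atom i) in e
  ... | true  = refl
  ... | false = contradiction (subst (atom i ∈_) Δ≡[] (atom∈Δ V A o e)) λ ()

∈⇒⊢⇒^⁺ : ∀ L A → C ∈ L → K ⊢id C ⇒ (L ^⁺ A)
∈⇒⊢⇒^⁺ (B ∷ L) A (here refl) = ax4 B (L ^⁺ A)
∈⇒⊢⇒^⁺ (B ∷ L) A (there p)   = ⇒-trans (∈⇒⊢⇒^⁺ L A p) (ax5 (L ^⁺ A) B)

⊢⇒^⁺ : ∀ L A → K ⊢id A ⇒ (L ^⁺ A)
⊢⇒^⁺ []      A = ⇒-refl
⊢⇒^⁺ (B ∷ L) A = ⇒-trans (⊢⇒^⁺ L A) (ax5 (L ^⁺ A) B)

∈⇒⊢⇒bigOr₁ : ∀ B L → C ∈ B ∷ L → K ⊢id C ⇒ bigOr₁ B L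
∈⇒⊢⇒bigOr₁ B []      (here refl) = ⇒-refl
∈⇒⊢⇒bigOr₁ B (E ∷ L) (here refl) = ax4 B (bigOr₁ E L)
∈⇒⊢⇒bigOr₁ B (E ∷ L) (there p)   = ⇒-trans (∈⇒⊢⇒bigOr₁ E L p) (ax5 (bigOr₁ E L) B)

mainTheorem10 : (A : Form) → IsID A → (V : Valuation) →
    (val V A ≡ true → Γ[ V , A ] ⊢id (Δ[ V , A ] ^⁺ A)) ×
    (val V A ≡ false → Γ[ V , A ] ⊢id (Δ[ V , A ] ^∼ A))
mainTheorem10 A idA V = true-case , false-case
  where
  kalmár-at : ∀ D → (∀ {q} → q ∈ Δ[ V , A ] → Γ[ V , A ] ⊢id q ⇒ D) →
    ∀ {b} → val V A ≡ b → Γ[ V , A ] ⊢id decided D b A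
  kalmár-at D ¬Δ e = subst (λ b → _ ⊢id decided D b A) e (kalmár V idA (atoms-decided V A ¬Δ))

  true-case : val V A ≡ true → Γ[ V , A ] ⊢id (Δ[ V , A ] ^⁺ A)
  true-case e = mp (kalmár-at (Δ[ V , A ] ^⁺ A) (∈⇒⊢⇒^⁺ Δ[ V , A ] A) e) (⊢⇒^⁺ Δ[ V , A ] A)

  false-case : val V A ≡ false → Γ[ V , A ] ⊢id (Δ[ V , A ] ^∼ A)
  false-case e with Δ[ V , A ] in Δ≡
  ... | []    = contradiction (trans (sym (Δ-empty⇒true V A Δ≡)) e) λ ()
  ... | B ∷ L = kalmár-at (bigOr₁ B L) (∈⇒⊢⇒bigOr₁ B L ∘ subst (_ ∈_) Δ≡) e
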